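{- Let $F$ be a CNF formula with $m$ clauses and $(T,\delta)$ a decomposition tree of $I(F)$ of index $k$. For every node $z$ of $T$, $|\Phi_z|\le(m+1)^k$ and $|\Psi_z|\le(m+1)^k$.
   Context: A clause is a finite set of literals (variables $x$ or negations $\bar x$) not containing both $x$ and $\bar x$; a CNF formula $F$ is a finite set of clauses; $\mathrm{var}(C)$, $\mathrm{var}(F)$ denote occurring variables. The incidence graph $I(F)$ has vertex set $\mathrm{var}(F)\cup F$ and edges $Cx$ for $x\in\mathrm{var}(C)$. A decomposition tree of a graph $G=(V,E)$ is a pair $(T,\delta)$ with $T$ a rooted binary tree and $\delta$ a bijection from the leaves of $T$ to $V$. Each edge $e$ of $T$ induces a bipartition $(X,V\setminus X)$ where $X$ is the $\delta$-image of the leaves of one component of $T-e$. For proper nonempty $X\subseteq V$, $x\equiv_X y$ iff for all $w\in V\setminus X$: $xw\in E\Leftrightarrow yw\in E$; $\mathit{index}_G(X)$ is the number of classes of $\equiv_X$, $\iota_G(X)=\max(\mathit{index}_G(X),\mathit{index}_G(V\setminus X))$, and the index of $(T,\delta)$ is the maximum of $\iota_G(X)$ over bipartitions induced by edges of $T$. For a set of variables $X$, $2^X$ is the set of maps $\sigma:X\to\{0,1\}$ ($\sigma(\bar x)=1-\sigma(x)$); $\sigma$ satisfies $C$ if $\sigma(\ell)=1$ for some $\ell\in C$ with variable in $X$. For a set of clauses $G$, $G(\sigma)$ is the set of clauses of $G$ satisfied by $\sigma$, $\mathrm{Proj}(G,X)=\{G(\sigma):\sigma\in2^X\}$, and $G^{\supseteq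 X}=\{C\in G: X\subseteq\mathrm{var}(C)\}$. For a node $z$ of $T$ let $T_z$ be the subtree rooted at $z$ with leaf set $L(T_z)$; $\mathrm{var}_z=\mathrm{var}(F)\cap\delta(L(T_z))$, $F_z=F\cap\delta(L(T_z))$, $\overline{F_z}=F\setminus F_z$, $\overline{\mathrm{var}_z}=\mathrm{var}(F)\setminus\mathrm{var}_z$. Let $\mathcal{X}^{\uparrow}_z=\{X\subseteq\mathrm{var}_z:\exists C\in\overline{F_z},\ X=\mathrm{var}_z\cap\mathrm{var}(C)\}$ and $\mathcal{X}^{\downarrow}_z=\{X\subseteq\overline{\mathrm{var}_z}:\exists C\in F_z,\ X=\overline{\mathrm{var}_z}\cap\mathrm{var}(C)\}$. $\Phi_z$ is the set of functions $f$ with domain $\mathcal{X}^{\uparrow}_z$ such that $f(X)\in\mathrm{Proj}(\overline{F_z}^{\supseteq X},X)$ for every $X$; $\Psi_z$ is the set of functions $g$ with domain $\mathcal{X}^{\downarrow}_z$ such that $g(Y)\in\mathrm{Proj}(F_z^{\supseteq Y},Y)$ for every $Y$. -}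

module Defs where

open import Data.Nat using (ℕ; _⊔_)
open import Data.Fin using (Fin) renaming (_≟_ to _≟ᶠ_)
open import Data.Bool using (Bool; true; false; _∧_; _∨_; not; T) renaming (_≟_ to _≟ᵇ_)
open import Data.Maybe using (Maybe; just; nothing; is-just)
open import Data.List using (List; []; _∷_; _++_; map; length; foldr; filterᵇ; deduplicate; allFin)
open import Data.Bool.ListAction using (any; all)
import Data.List.Properties as LP
open import Data.List.Relation.Unary.Any using (any?)
open import Data.List.Relation.Unary.Unique.Propositional using (Unique)
open import Data.List.Membership.Propositional using (_∈_)
open import Data.Vec using (Vec; lookup; tabulate)
open import Data.Sum using (_⊎_; inj₁; inj₂)
import Data.Sum.Properties as SP
open import Data.Product using (Σ; _×_; _,_; proj₁)
open import Data.Unit using (⊤)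
open import Relation.Binary.PropositionalEquality using (_≡_)
open import Relation.Nullary.Decidable using (isYes; Dec)
open import Function.Bundles using (_⇔_)

-- A clause is a vector assigning to each variable
-- x either nothing (x does not occur), just true (literal x) or
-- just false (literal x̄); so a clause never contains both x and x̄.
-- A CNF formula with m clauses is a map Fin m → Clause n, required to
-- be injective (a formula is a *set* of clauses).

Clause : ℕ → Set
Clause n = Vec (Maybe Bool) n

CNF : ℕ → ℕ → Set
CNF n m = Fin m → Clause n

IsSetOfClauses : ∀ {n m} → CNF n m → Set
IsSetOfClauses {m = m} F = (i j : Fin m) → F i ≡ F j → i ≡ j

VarSet : ℕ → Set
VarSet n = Vec Bool n

ClauseSet : ℕ → Set
ClauseSet m = Vec Bool m

_∩ᵛ_ : ∀ {n} → VarSet n → VarSet n → VarSet n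
_∩ᵛ_ {n} X Y = tabulate (λ x → lookup X x ∧ lookup Y x)

_⊆ᵇ_ : ∀ {n} → VarSet n → VarSet n → Bool
_⊆ᵇ_ {n} X Y = all (λ x → not (lookup X x) ∨ lookup Y x) (allFin n)

varC : ∀ {n} → Clause n → VarSet n
varC C = tabulate (λ x → is-just (lookup C x))

varF : ∀ {n m} → CNF n m → Fin n → Bool
varF {m = m} F x = any (λ c → lookup (varC (F c)) x) (allFin m)

-- Incidence graph I(F): vertices var(F) ∪ F, realised inside Fin n ⊎ Fin m

Vertex : ℕ → ℕ → Set
Vertex n m = Fin n ⊎ Fin m

_≟ⱽ_ : ∀ {n m} (u v : Vertex n m) → Dec (u ≡ v)
_≟ⱽ_ = SP.≡-dec _≟ᶠ_ _≟ᶠ_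

InV : ∀ {n m} → CNF n m → Vertex n m → Set
InV F (inj₁ x) = T (varF F x)
InV F (inj₂ c) = ⊤

VList : ∀ {n m} → CNF n m → List (Vertex n m)
VList {n} {m} F = map inj₁ (filterᵇ (varF F) (allFin n)) ++ map inj₂ (allFin m)

adj : ∀ {n m} → CNF n m → Vertex n m → Vertex n m → Bool
adj F (inj₁ x) (inj₂ c) = lookup (varC (F c)) x
adj F (inj₂ c) (inj₁ x) = lookup (varC (F c)) x
adj F _ _ = false

_∈ᵇ_ : ∀ {n m} → Vertex n m → List (Vertex n m) → Bool
v ∈ᵇ xs = isYes (any? (v ≟ⱽ_) xs)

compl : ∀ {n m} → CNF n m → List (Vertex n m) → List (Vertex n m)
compl F X = filterᵇ (λ w → not (w ∈ᵇ X)) (VList F)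

-- the adjacency pattern of x towards V \ X ;  x ≡_X y  iff  row x ≡ row y
row : ∀ {n m} → CNF n m → List (Vertex n m) → Vertex n m → List Bool
row F X x = map (adj F x) (compl F X)

-- index_G(X) = number of ≡_X classes = number of distinct rows among x ∈ X
indexG : ∀ {n m} → CNF n m → List (Vertex n m) → ℕ
indexG F X = length (deduplicate (LP.≡-dec _≟ᵇ_) (map (row F X) X))

ι : ∀ {n m} → CNF n m → List (Vertex n m) → ℕ
ι F X = indexG F X ⊔ indexG F (compl F X)

data DTree (A : Set) : Set where
  leaf : A → DTree A
  node : DTree A → DTree A → DTree A

leaves : ∀ {A} → DTree A → List A
leaves (leaf a) = a ∷ []
leaves (node l r) = leaves l ++ leaves r

-- all nodes z of T, each represented by its subtree T_z (root included)
subtrees : ∀ {A} → DTree A → List (DTree A)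
subtrees (leaf a) = leaf a ∷ []
subtrees (node l r) = node l r ∷ (subtrees l ++ subtrees r)

-- the non-root nodes; the edge from such a node z to its parent induces
-- the bipartition (δ(L(T_z)), V \ δ(L(T_z)))
properSubtrees : ∀ {A} → DTree A → List (DTree A)
properSubtrees (leaf a) = []
properSubtrees (node l r) = subtrees l ++ subtrees r

IsDecompTree : ∀ {n m} → CNF n m → DTree (Vertex n m) → Set
IsDecompTree {n} {m} F T =
  Unique (leaves T) × ((v : Vertex n m) → (v ∈ leaves T) ⇔ InV F v)

-- index of (T, δ): maximum of ι over edge bipartitions (0 if T has no edge)
treeIndex : ∀ {n m} → CNF n m → DTree (Vertex n m) → ℕ
treeIndex F T = foldr _⊔_ 0 (map (λ z → ι F (leaves z)) (properSubtrees T))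

litTrue : Maybe Bool → Bool → Bool
litTrue nothing _ = false
litTrue (just true) v = v
litTrue (just false) v = not v

-- σ ∈ 2^X (given as a total assignment; only values on X are used)
-- satisfies C: some literal of C with variable in X is made true
satBy : ∀ {n} → VarSet n → (Fin n → Bool) → Clause n → Bool
satBy {n} X σ C = any (λ x → lookup X x ∧ litTrue (lookup C x) (σ x)) (allFin n)

Gσ : ∀ {n m} → CNF n m → (Fin m → Bool) → VarSet n → (Fin n → Bool) → ClauseSet m
Gσ F G X σ = tabulate (λ c → G c ∧ satBy X σ (F c))

InProj : ∀ {n m} → CNF n m → (Fin m → Bool) → VarSet n → ClauseSet m → Set
InProj {n} F G X S = Σ (Fin n → Bool) (λ σ → S ≡ Gσ F G X σ)

module _ {n m : ℕ} (F : CNF n m) (z : DTree (Vertex n m)) where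

  inZ : Vertex n m → Bool
  inZ v = v ∈ᵇ leaves z

  varz : VarSet n
  varz = tabulate (λ x → varF F x ∧ inZ (inj₁ x))

  varzᶜ : VarSet n
  varzᶜ = tabulate (λ x → varF F x ∧ not (inZ (inj₁ x)))

  XUp : VarSet n → Set
  XUp X = Σ (Fin m) (λ c → (inZ (inj₂ c) ≡ false) × (X ≡ (varz ∩ᵛ varC (F c))))

  XDown : VarSet n → Set
  XDown Y = Σ (Fin m) (λ c → (inZ (inj₂ c) ≡ true) × (Y ≡ (varzᶜ ∩ᵛ varC (F c))))

  outSup : VarSet n → Fin m → Bool
  outSup X c = not (inZ (inj₂ c)) ∧ (X ⊆ᵇ varC (F c))

  inSup : VarSet n → Fin m → Bool
  inSup Y c = inZ (inj₂ c) ∧ (Y ⊆ᵇ varC (F c))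

  -- Φ_z: functions on 𝒳↑_z (compared pointwise on 𝒳↑_z)
  Φ : Set
  Φ = Σ (VarSet n → ClauseSet m) (λ f → (X : VarSet n) → XUp X → InProj F (outSup X) X (f X))

  _≈Φ_ : Φ → Φ → Set
  f ≈Φ g = (X : VarSet n) → XUp X → proj₁ f X ≡ proj₁ g X

  -- Ψ_z: functions on 𝒳↓_z (compared pointwise on 𝒳↓_z)
  Ψ : Set
  Ψ = Σ (VarSet n → ClauseSet m) (λ g → (Y : VarSet n) → XDown Y → InProj F (inSup Y) Y (g Y))

  _≈Ψ_ : Ψ → Ψ → Set
  f ≈Ψ g = (Y : VarSet n) → XDown Y → proj₁ f Y ≡ proj₁ g Y

-- |A / ≈| ≤ N : an injection (modulo ≈) into Fin N
CardLE : (A : Set) → (A → A → Set) → ℕ → Set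
CardLE A _≈_ N = Σ (A → Fin N) (λ h → (a b : A) → h a ≡ h b → a ≈ b)

-- A function f ∈ Φ_z is determined by its values on the sets X = var_z ∩ var(C),
-- C ∉ F_z. Two clauses with the same neighbourhood outside z give the same X,
-- so there are at most index(V \ δ(L(T_z))) ≤ k such sets. Each value f(X) is a
-- projection of clauses all containing X; an assignment on X either satisfies
-- all of them or falsifies some C, and then it is the unique assignment of X
-- falsifying C. Hence f(X) takes at most m + 1 values, and |Φ_z| ≤ (m+1)^k.
-- Ψ_z is symmetric. At the root there is no edge above z, but there 𝒳↑_z = ∅
-- and 𝒳↓_z = {∅}, so Φ_z and Ψ_z are singletons.
module Submission where

open import Defs
open import Data.Bool using (Bool; true; false; _∧_; _∨_; not; T; T?) renaming (_≟_ to _≟ᵇ_)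
open import Data.Bool.Properties using (T-∧; T-not-≡)
open import Data.Empty using (⊥-elim)
open import Data.Fin using (Fin; zero; suc; combine; inject≤; fromℕ<)
import Data.Fin.Properties as Fin
open import Data.List using (List; []; _∷_; map; length; foldr; filterᵇ; deduplicate; allFin)
open import Data.Bool.ListAction using (or)
open import Data.List.Properties using (length-map; ∷-injective; ≡-dec; map-cong)
open import Data.List.Membership.Propositional using (_∈_; _∉_; lose)
open import Data.List.Membership.Propositional.Properties
  using (∈-allFin; ∈-map⁺; ∈-++⁺ˡ; ∈-++⁺ʳ; ∈-filter⁺; ∈-filter⁻; ∈-deduplicate⁺)
open import Data.List.Relation.Unary.All using (All; []; _∷_; lookup)
open import Data.List.Relation.Unary.All.Properties using (all⁺)
open import Data.List.Relation.Unary.Any using (here; there)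
open import Data.List.Relation.Unary.Any.Properties using (any⁺)
open import Data.Maybe using (Maybe; just; maybe′; is-just)
open import Data.Nat using (ℕ; suc; _^_; _≤_; _⊔_; NonZero; >-nonZero⁻¹)
open import Data.Nat.Properties using (^-monoʳ-≤; m^n≢0; m≤m⊔n; m≤n⊔m; m≤n⇒m≤o⊔n; ≤-trans)
open import Data.Product using (Σ; ∃-syntax; _×_; _,_; proj₁; proj₂)
open import Data.Sum using (_⊎_; inj₁; inj₂)
open import Data.Unit using (tt)
import Data.Vec as Vec
open import Data.Vec.Properties using (lookup∘tabulate; tabulate-cong)
import Data.Vec.Properties as Vecₚ
open import Function.Base using (_∘_)
open import Function.Bundles using (Equivalence)
open import Relation.Binary.Definitions using (DecidableEquality)
open import Relation.Binary.PropositionalEquality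
open import Relation.Nullary using (¬_; yes; no)
open import Relation.Nullary.Decidable using (toWitness; fromWitness; toWitnessFalse; fromWitnessFalse)

private
  variable
    A B C V : Set
    n m s : ℕ

CardLE-weaken : {_≈_ : A → A → Set} {N N′ : ℕ} →
  CardLE A _≈_ N → N ≤ N′ → CardLE A _≈_ N′
CardLE-weaken (h , h-inj) N≤N′ =
  (λ a → inject≤ (h a) N≤N′) ,
  λ a b eq → h-inj a b (Fin.inject≤-injective N≤N′ N≤N′ (h a) (h b) eq)

CardLE-trivial : {_≈_ : A → A → Set} (N : ℕ) .{{_ : NonZero N}} →
  (∀ a b → a ≈ b) → CardLE A _≈_ N
CardLE-trivial N all≈ = (λ _ → fromℕ< (>-nonZero⁻¹ N)) , λ a b _ → all≈ a b

encode : (xs : List A) → (A → Fin s) → Fin (s ^ length xs)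
encode []       e = zero
encode (x ∷ xs) e = combine (e x) (encode xs e)

encode-injective : (xs : List A) (e e′ : A → Fin s) →
  encode xs e ≡ encode xs e′ → All (λ x → e x ≡ e′ x) xs
encode-injective []       e e′ _  = []
encode-injective (x ∷ xs) e e′ eq =
  let ex≡e′x , rest = Fin.combine-injective (e x) (encode xs e) (e′ x) (encode xs e′) eq
  in ex≡e′x ∷ encode-injective xs e e′ rest

module _ (Dom : A → Set) (Adm : A → V → Set) where

  RestrictedFun : Set
  RestrictedFun = Σ (A → V) λ f → ∀ x → Dom x → Adm x (f x)

  _≈on-Dom_ : RestrictedFun → RestrictedFun → Set
  f ≈on-Dom g = ∀ x → Dom x → proj₁ f x ≡ proj₁ g x

  CardLE-RestrictedFun : ∀ {s} → DecidableEquality V → (xs : List A) → (∀ x → Dom x → x ∈ xs) →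
    (cand : A → Fin (suc s) → V) → (∀ x v → Adm x v → ∃[ i ] cand x i ≡ v) →
    CardLE RestrictedFun _≈on-Dom_ (suc s ^ length xs)
  CardLE-RestrictedFun {s} _≟_ xs Dom⊆xs cand adm⇒cand =
    (λ f → encode xs (index f)) , λ f g eq x x∈Dom →
      let index-eq = lookup (encode-injective xs (index f) (index g) eq) (Dom⊆xs x x∈Dom)
      in begin
        proj₁ f x                 ≡⟨ index-correct f x x∈Dom ⟨
        cand x (index f x)        ≡⟨ cong (cand x) index-eq ⟩
        cand x (index g x)        ≡⟨ index-correct g x x∈Dom ⟩
        proj₁ g x                 ∎
    where
    open ≡-Reasoning

    index : RestrictedFun → A → Fin (suc s)
    index f x with Fin.any? (λ i → cand x i ≟ proj₁ f x)
    ... | yes (i , _) = i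
    ... | no _        = zero

    index-correct : ∀ f x → Dom x → cand x (index f x) ≡ proj₁ f x
    index-correct f x x∈Dom with Fin.any? (λ i → cand x i ≟ proj₁ f x)
    ... | yes (_ , eq) = eq
    ... | no ¬cand     = ⊥-elim (¬cand (adm⇒cand x (proj₁ f x) (proj₂ f x x∈Dom)))

satBy-cong : ∀ (X : VarSet n) {σ τ} (C : Clause n) →
  (∀ x → T (Vec.lookup X x) → σ x ≡ τ x) → satBy X σ C ≡ satBy X τ C
satBy-cong {n} X {σ} {τ} C σ≈τ = cong or (map-cong literal-cong (allFin n))
  where
  literal-cong : ∀ x → (Vec.lookup X x ∧ litTrue (Vec.lookup C x) (σ x))
                     ≡ (Vec.lookup X x ∧ litTrue (Vec.lookup C x) (τ x))
  literal-cong x with Vec.lookup X x in X[x]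
  ... | false = refl
  ... | true  = cong (litTrue (Vec.lookup C x)) (σ≈τ x (subst T (sym X[x]) tt))

Gσ-cong : ∀ (F : CNF n m) G (X : VarSet n) {σ τ} →
  (∀ x → T (Vec.lookup X x) → σ x ≡ τ x) → Gσ F G X σ ≡ Gσ F G X τ
Gσ-cong F G X σ≈τ = tabulate-cong λ c → cong (G c ∧_) (satBy-cong X (F c) σ≈τ)

falsifier : Clause n → Fin n → Bool
falsifier C x = maybe′ not false (Vec.lookup C x)

falsified-literal : ∀ (ℓ : Maybe Bool) b → T (is-just ℓ) → ¬ T (litTrue ℓ b) →
  b ≡ maybe′ not false ℓ
falsified-literal (just true)  true  _ ¬true = ⊥-elim (¬true tt)
falsified-literal (just true)  false _ _     = refl
falsified-literal (just false) true  _ _     = refl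
falsified-literal (just false) false _ ¬true = ⊥-elim (¬true tt)

falsified⇒falsifier : ∀ (X : VarSet n) σ (C : Clause n) →
  T (X ⊆ᵇ varC C) → ¬ T (satBy X σ C) → ∀ x → T (Vec.lookup X x) → σ x ≡ falsifier C x
falsified⇒falsifier {n} X σ C X⊆C ¬sat x X[x] =
  falsified-literal (Vec.lookup C x) (σ x) occurs ¬literal
  where
  modus-ponens : ∀ a {b} → T (not a ∨ b) → T a → T b
  modus-ponens true a⇒b _ = a⇒b

  occurs : T (is-just (Vec.lookup C x))
  occurs = subst T (lookup∘tabulate _ x)
    (modus-ponens (Vec.lookup X x) (lookup (all⁺ _ (allFin n) X⊆C) (∈-allFin x)) X[x])

  ¬literal : ¬ T (litTrue (Vec.lookup C x) (σ x))
  ¬literal lit = ¬sat (any⁺ _ (lose (∈-allFin x) (Equivalence.from T-∧ (X[x] , lit))))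

projCandidate : CNF n m → (Fin m → Bool) → VarSet n → Fin (suc m) → ClauseSet m
projCandidate F G X zero    = Vec.tabulate G
projCandidate F G X (suc c) = Gσ F G X (falsifier (F c))

InProj⇒projCandidate : ∀ (F : CNF n m) G (X : VarSet n) →
  (∀ c → T (G c) → T (X ⊆ᵇ varC (F c))) →
  ∀ S → InProj F G X S → ∃[ i ] projCandidate F G X i ≡ S
InProj⇒projCandidate F G X G⊇X _ (σ , refl)
  with Fin.any? (λ c → T? (G c ∧ not (satBy X σ (F c))))
... | yes (c , falsified) =
  let G[c] , ¬sat = Equivalence.to T-∧ falsified
  in suc c , sym (Gσ-cong F G X (falsified⇒falsifier X σ (F c) (G⊇X c G[c])
                   (subst T (Equivalence.to T-not-≡ ¬sat))))
... | no none = zero , tabulate-cong all-satisfied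
  where
  all-satisfied : ∀ c → G c ≡ (G c ∧ satBy X σ (F c))
  all-satisfied c with G c in G[c] | satBy X σ (F c) in sat
  ... | false | _     = refl
  ... | true  | true  = refl
  ... | true  | false =
    ⊥-elim (none (c , subst T (sym (cong₂ (λ g b → g ∧ not b) G[c] sat)) tt))

factorise : DecidableEquality B → C → (r : Fin m → B) (g : Fin m → C) →
  (∀ c d → r c ≡ r d → g c ≡ g d) → Σ (B → C) λ h → ∀ c → h (r c) ≡ g c
factorise {B = B} {C = C} _≟_ default r g r-determines-g = h , h∘r≗g
  where
  h : B → C
  h b with Fin.any? (λ c → r c ≟ b)
  ... | yes (c , _) = g c
  ... | no _        = default

  h∘r≗g : ∀ c → h (r c) ≡ g c
  h∘r≗g c with Fin.any? (λ d → r d ≟ r c)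
  ... | yes (d , rd≡rc) = r-determines-g d c rd≡rc
  ... | no none         = ⊥-elim (none (c , refl))

map≡map⇒≡ : ∀ (f g : A → B) {xs x} → map f xs ≡ map g xs → x ∈ xs → f x ≡ g x
map≡map⇒≡ f g eq (here refl) = proj₁ (∷-injective eq)
map≡map⇒≡ f g eq (there x∈xs) = map≡map⇒≡ f g (proj₂ (∷-injective eq)) x∈xs

module _ (F : CNF n m) (P : List (Vertex n m)) (W : VarSet n)
         (W⊆P̅ : ∀ x → T (Vec.lookup W x) → inj₁ x ∈ compl F P) where

  -- The row of a clause C records var(C) on all variables outside P, hence on W.
  row-determines-∩ : ∀ c d → row F P (inj₂ c) ≡ row F P (inj₂ d) →
    W ∩ᵛ varC (F c) ≡ W ∩ᵛ varC (F d)
  row-determines-∩ c d rows≡ = tabulate-cong agree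
    where
    agree : ∀ x → (Vec.lookup W x ∧ Vec.lookup (varC (F c)) x)
                ≡ (Vec.lookup W x ∧ Vec.lookup (varC (F d)) x)
    agree x with Vec.lookup W x in W[x]
    ... | false = refl
    ... | true  = map≡map⇒≡ (adj F (inj₂ c)) (adj F (inj₂ d)) rows≡ (W⊆P̅ x (subst T (sym W[x]) tt))

  ∩-cover : Σ (List (VarSet n)) λ Xs →
    length Xs ≡ indexG F P × (∀ c → inj₂ c ∈ P → W ∩ᵛ varC (F c) ∈ Xs)
  ∩-cover = map h rows , length-map h rows , covered
    where
    rows : List (List Bool)
    rows = deduplicate (≡-dec _≟ᵇ_) (map (row F P) P)

    factorisation : Σ (List Bool → VarSet n) λ h → ∀ c → h (row F P (inj₂ c)) ≡ W ∩ᵛ varC (F c)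
    factorisation = factorise (≡-dec _≟ᵇ_) W (λ c → row F P (inj₂ c))
                      (λ c → W ∩ᵛ varC (F c)) row-determines-∩

    h : List Bool → VarSet n
    h = proj₁ factorisation

    covered : ∀ c → inj₂ c ∈ P → W ∩ᵛ varC (F c) ∈ map h rows
    covered c c∈P = subst (_∈ map h rows) (proj₂ factorisation c)
      (∈-map⁺ h (∈-deduplicate⁺ (≡-dec _≟ᵇ_) (∈-map⁺ (row F P) c∈P)))

  CardLE-ProjFun : (Dom : VarSet n → Set) → (∀ X → Dom X → ∃[ c ] inj₂ c ∈ P × X ≡ W ∩ᵛ varC (F c)) →
    (G : VarSet n → Fin m → Bool) → (∀ X c → T (G X c) → T (X ⊆ᵇ varC (F c))) →
    CardLE (RestrictedFun Dom (λ X → InProj F (G X) X))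
           (_≈on-Dom_ Dom (λ X → InProj F (G X) X)) (suc m ^ indexG F P)
  CardLE-ProjFun Dom Dom⊆∩ G G⊇X =
    let Xs , |Xs| , covered = ∩-cover
    in subst (λ k → CardLE _ _ (suc m ^ k)) |Xs|
         (CardLE-RestrictedFun Dom (λ X → InProj F (G X) X) (Vecₚ.≡-dec _≟ᵇ_) Xs
           (λ X X∈Dom → let c , c∈P , X≡ = Dom⊆∩ X X∈Dom in subst (_∈ Xs) (sym X≡) (covered c c∈P))
           (λ X → projCandidate F (G X) X)
           (λ X → InProj⇒projCandidate F (G X) X (G⊇X X)))

∈-compl⁺ : ∀ (F : CNF n m) P {w} → w ∈ VList F → w ∉ P → w ∈ compl F P
∈-compl⁺ F P w∈V w∉P = ∈-filter⁺ (λ w → T? (not (w ∈ᵇ P))) w∈V (fromWitnessFalse w∉P)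

∈-compl⁻ : ∀ (F : CNF n m) P {w} → w ∈ compl F P → w ∉ P
∈-compl⁻ F P w∈P̅ = toWitnessFalse (proj₂ (∈-filter⁻ (λ w → T? (not (w ∈ᵇ P))) {xs = VList F} w∈P̅))

var∈VList : ∀ (F : CNF n m) {x} → T (varF F x) → inj₁ x ∈ VList F
var∈VList {n} F {x} x∈F = ∈-++⁺ˡ (∈-map⁺ inj₁ (∈-filter⁺ (T? ∘ varF F) (∈-allFin x) x∈F))

clause∈VList : ∀ (F : CNF n m) c → inj₂ c ∈ VList F
clause∈VList {n} {m} F c =
  ∈-++⁺ʳ (map inj₁ (filterᵇ (varF F) (allFin n))) (∈-map⁺ inj₂ (∈-allFin c))

Φ-bound : ∀ (F : CNF n m) z → CardLE (Φ F z) (_≈Φ_ F z) (suc m ^ indexG F (compl F (leaves z)))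
Φ-bound F z =
  CardLE-ProjFun F (compl F (leaves z)) (varz F z) varz⊆P̅ (XUp F z) XUp⊆∩ (outSup F z)
    (λ X c → proj₂ ∘ Equivalence.to T-∧)
  where
  varz⊆P̅ : ∀ x → T (Vec.lookup (varz F z) x) → inj₁ x ∈ compl F (compl F (leaves z))
  varz⊆P̅ x x∈varz =
    let x∈F , x∈z = Equivalence.to T-∧ (subst T (lookup∘tabulate _ x) x∈varz)
    in ∈-compl⁺ F _ (var∈VList F x∈F) (λ x∉z → ∈-compl⁻ F (leaves z) x∉z (toWitness x∈z))

  XUp⊆∩ : ∀ X → XUp F z X → ∃[ c ] inj₂ c ∈ compl F (leaves z) × X ≡ varz F z ∩ᵛ varC (F c)
  XUp⊆∩ X (c , c∉z , X≡) =
    c , ∈-compl⁺ F _ (clause∈VList F c) (λ c∈z → subst T c∉z (fromWitness c∈z)) , X≡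

Ψ-bound : ∀ (F : CNF n m) z → CardLE (Ψ F z) (_≈Ψ_ F z) (suc m ^ indexG F (leaves z))
Ψ-bound F z =
  CardLE-ProjFun F (leaves z) (varzᶜ F z) varzᶜ⊆P̅ (XDown F z) XDown⊆∩ (inSup F z)
    (λ Y c → proj₂ ∘ Equivalence.to T-∧)
  where
  varzᶜ⊆P̅ : ∀ x → T (Vec.lookup (varzᶜ F z) x) → inj₁ x ∈ compl F (leaves z)
  varzᶜ⊆P̅ x x∈varzᶜ =
    let x∈F , x∉z = Equivalence.to T-∧ (subst T (lookup∘tabulate _ x) x∈varzᶜ)
    in ∈-compl⁺ F _ (var∈VList F x∈F) (toWitnessFalse x∉z)

  XDown⊆∩ : ∀ Y → XDown F z Y → ∃[ c ] inj₂ c ∈ leaves z × Y ≡ varzᶜ F z ∩ᵛ varC (F c)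
  XDown⊆∩ Y (c , c∈z , Y≡) = c , toWitness (subst T (sym c∈z) tt) , Y≡

InProj-unique : ∀ (F : CNF n m) G (X : VarSet n) {S S′} → (∀ x → ¬ T (Vec.lookup X x)) →
  InProj F G X S → InProj F G X S′ → S ≡ S′
InProj-unique F G X X≡∅ (σ , S≡) (τ , S′≡) =
  trans S≡ (trans (Gσ-cong F G X (λ x x∈X → ⊥-elim (X≡∅ x x∈X))) (sym S′≡))

module _ (F : CNF n m) (t : DTree (Vertex n m)) (t-decomp : IsDecompTree F t) where

  inZ-root : ∀ v → InV F v → T (inZ F t v)
  inZ-root v v∈V = fromWitness (Equivalence.from (proj₂ t-decomp v) v∈V)

  Φ-root-trivial : ∀ f g → _≈Φ_ F t f g
  Φ-root-trivial _ _ _ (c , c∉t , _) = ⊥-elim (subst T c∉t (inZ-root (inj₂ c) tt))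

  Ψ-root-trivial : ∀ f g → _≈Ψ_ F t f g
  Ψ-root-trivial (f , f-adm) (g , g-adm) Y Y∈𝒳@(c , _ , refl) =
    InProj-unique F (inSup F t Y) Y Y≡∅ (f-adm Y Y∈𝒳) (g-adm Y Y∈𝒳)
    where
    Y≡∅ : ∀ x → ¬ T (Vec.lookup (varzᶜ F t ∩ᵛ varC (F c)) x)
    Y≡∅ x x∈Y =
      let x∈varzᶜ = proj₁ (Equivalence.to T-∧ (subst T (lookup∘tabulate _ x) x∈Y))
          x∈F , x∉t = Equivalence.to T-∧ (subst T (lookup∘tabulate _ x) x∈varzᶜ)
      in subst T (Equivalence.to T-not-≡ x∉t) (inZ-root (inj₁ x) x∈F)

≤-foldr-⊔ : ∀ {x} xs → x ∈ xs → x ≤ foldr _⊔_ 0 xs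
≤-foldr-⊔ (y ∷ xs) (here refl)  = m≤m⊔n y _
≤-foldr-⊔ (y ∷ xs) (there x∈xs) = m≤n⇒m≤o⊔n y (≤-foldr-⊔ xs x∈xs)

subtree⇒root⊎proper : ∀ {t z : DTree A} → z ∈ subtrees t → z ≡ t ⊎ z ∈ properSubtrees t
subtree⇒root⊎proper {t = leaf _}   (here refl) = inj₁ refl
subtree⇒root⊎proper {t = node _ _} (here refl) = inj₁ refl
subtree⇒root⊎proper {t = node _ _} (there z∈t) = inj₂ z∈t

ι≤treeIndex : ∀ (F : CNF n m) t {z} → z ∈ properSubtrees t → ι F (leaves z) ≤ treeIndex F t
ι≤treeIndex F t z∈t = ≤-foldr-⊔ _ (∈-map⁺ (λ z → ι F (leaves z)) z∈t)

lemma7 : {n m : ℕ} (F : CNF n m) → IsSetOfClauses F →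
    (T : DTree (Vertex n m)) → IsDecompTree F T →
    (k : ℕ) → treeIndex F T ≡ k →
    (z : DTree (Vertex n m)) → z ∈ subtrees T →
    CardLE (Φ F z) (_≈Φ_ F z) (suc m ^ k) × CardLE (Ψ F z) (_≈Ψ_ F z) (suc m ^ k)
lemma7 {m = m} F _ T T-decomp k refl z z∈T with subtree⇒root⊎proper z∈T
... | inj₁ refl =
  CardLE-trivial (suc m ^ k) {{m^n≢0 (suc m) k}} (Φ-root-trivial F T T-decomp) ,
  CardLE-trivial (suc m ^ k) {{m^n≢0 (suc m) k}} (Ψ-root-trivial F T T-decomp)
... | inj₂ z∈T⁺ =
  CardLE-weaken (Φ-bound F z) (^-monoʳ-≤ (suc m) (≤-trans (m≤n⊔m (indexG F (leaves z)) _) ι≤k)) ,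
  CardLE-weaken (Ψ-bound F z) (^-monoʳ-≤ (suc m) (≤-trans (m≤m⊔n _ (indexG F (compl F (leaves z)))) ι≤k))
  where
  ι≤k : ι F (leaves z) ≤ k
  ι≤k = ι≤treeIndex F T z∈T⁺
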